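{- For every positive integer $n$, \[ \sum_{k=0}^{n-1}\mathbb{F}_{k}^{2}=n\,\mathbb{F}_{n}^{2}-\sum_{k=0}^{n-1}\frac{k+1}{F_{k+1}}\left(2\mathbb{F}_{k}+\frac{1}{F_{k+1}}\right). \]
   Context: $F_n$ denotes the Fibonacci numbers: $F_0=0$, $F_1=1$, $F_{n+2}=F_{n+1}+F_n$. The $n$-th harmonic Fibonacci number is $\mathbb{F}_{n}=\sum_{k=1}^{n}\frac{1}{F_{k}}$ for $n\ge 1$, with $\mathbb{F}_0=0$ (empty sum). -}

module Defs where

open import Data.Nat as ℕ using (ℕ; zero; suc)
import Data.Nat.Properties as ℕP
open import Data.Integer using (+_)
open import Data.Rational using (ℚ; 0ℚ; _+_; _/_)

F : ℕ → ℕ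
F zero = 0
F (suc zero) = 1
F (suc (suc n)) = F (suc n) ℕ.+ F n

F-suc-pos : ∀ k → 1 ℕ.≤ F (suc k)
F-suc-pos zero = ℕ.s≤s ℕ.z≤n
F-suc-pos (suc k) = ℕP.≤-trans (F-suc-pos k) (ℕP.m≤m+n (F (suc k)) (F k))

F-suc-nonZero : ∀ k → ℕ.NonZero (F (suc k))
F-suc-nonZero k = ℕ.>-nonZero (F-suc-pos k)

invFibSuc : ℕ → ℚ
invFibSuc k = (+ 1 / F (suc k)) {{F-suc-nonZero k}}

sumTo : ℕ → (ℕ → ℚ) → ℚ
sumTo zero f = 0ℚ
sumTo (suc n) f = sumTo n f + f n

-- harmonic Fibonacci number: HF n = Σ_{k=1}^{n} 1 / F k  (HF 0 = 0)
HF : ℕ → ℚ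
HF n = sumTo n invFibSuc

{-# OPTIONS --safe #-}
module Submission where

-- Nothing Fibonacci-specific is used: for any sequence a with partial sums
-- S k = a 0 + … + a (k-1), passing from n to n+1 adds S n ² to the left-hand
-- side, while (n+1) S (n+1)² - n S n² = S n² + (n+1) a n (2 S n + a n) on the
-- right, so the identity holds for every n by induction.

open import Defs
open import Data.Nat using (ℕ; suc; zero)
open import Data.Integer as ℤ using (+_)
import Data.Integer.Properties as ℤ
import Data.Nat.Coprimality as Coprimality
open import Data.Rational using (ℚ; mkℚ; _+_; _-_; _*_; _/_; 1ℚ)
open import Data.Rational.Properties using (/-cong; normalize-coprime)
open import Data.Rational.Solver using (module +-*-Solver)
open import Relation.Binary.PropositionalEquality using (_≡_; refl; trans; cong; sym; module ≡-Reasoning)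

ℕ/1-suc : ∀ n → + suc n / 1 ≡ + n / 1 + 1ℚ
ℕ/1-suc n = begin
  + suc n / 1                  ≡⟨ /-cong numerator refl ⟩
  (+ n ℤ.* + 1 ℤ.+ + 1) / 1   ≡⟨⟩
  mkℚ (+ n) 0 coprime + 1ℚ    ≡⟨ cong (_+ 1ℚ) (sym (normalize-coprime coprime)) ⟩
  + n / 1 + 1ℚ                 ∎
  where
  open ≡-Reasoning
  coprime : Coprimality.Coprime n 1
  coprime = Coprimality.sym (Coprimality.1-coprimeTo n)
  numerator : + suc n ≡ + n ℤ.* + 1 ℤ.+ + 1
  numerator = trans (ℤ.+-comm (+ 1) (+ n)) (cong (ℤ._+ + 1) (sym (ℤ.*-identityʳ (+ n))))

square-partialSum-step : ∀ (N S a T : ℚ) →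
  (N * (S * S) - T) + S * S
    ≡ (N + 1ℚ) * ((S + a) * (S + a)) - (T + ((N + 1ℚ) * a) * ((+ 2 / 1) * S + a))
square-partialSum-step = solve 4 (λ N S a T →
  (N :* (S :* S) :- T) :+ S :* S
    := (N :+ con 1ℚ) :* ((S :+ a) :* (S :+ a)) :- (T :+ ((N :+ con 1ℚ) :* a) :* (con (+ 2 / 1) :* S :+ a))) refl
  where open +-*-Solver

sumTo-square-partialSums : ∀ (a : ℕ → ℚ) n → let S k = sumTo k a in
  sumTo n (λ k → S k * S k)
    ≡ (+ n / 1) * (S n * S n) - sumTo n (λ k → ((+ suc k / 1) * a k) * ((+ 2 / 1) * S k + a k))
sumTo-square-partialSums a zero    = refl
sumTo-square-partialSums a (suc n) = begin
  sumTo n (λ k → S k * S k) + S n * S n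
    ≡⟨ cong (_+ S n * S n) (sumTo-square-partialSums a n) ⟩
  (+ n / 1) * (S n * S n) - T + S n * S n
    ≡⟨ square-partialSum-step (+ n / 1) (S n) (a n) T ⟩
  (+ n / 1 + 1ℚ) * (S (suc n) * S (suc n)) - (T + ((+ n / 1 + 1ℚ) * a n) * ((+ 2 / 1) * S n + a n))
    ≡⟨ cong (λ N → N * (S (suc n) * S (suc n)) - (T + (N * a n) * ((+ 2 / 1) * S n + a n))) (sym (ℕ/1-suc n)) ⟩
  (+ suc n / 1) * (S (suc n) * S (suc n)) - (T + ((+ suc n / 1) * a n) * ((+ 2 / 1) * S n + a n))
    ∎
  where
  open ≡-Reasoning
  S : ℕ → ℚ
  S k = sumTo k a
  T : ℚ
  T = sumTo n (λ k → ((+ suc k / 1) * a k) * ((+ 2 / 1) * S k + a k))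

mainTheorem2 : (m : ℕ) → let n = suc m in
    sumTo n (λ k → HF k * HF k)
      ≡ ((+ n / 1) * (HF n * HF n))
        - sumTo n (λ k → ((+ (suc k) / 1) * invFibSuc k)
                          * (((+ 2 / 1) * HF k) + invFibSuc k))
mainTheorem2 m = sumTo-square-partialSums invFibSuc (suc m)
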